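{- Let $\mathbf P=(P,\leq)$ be a poset, let $f\colon P\to P$ be strongly monotone and let $\Theta$ be an $S$-equivalence on $\mathbf P$. Define a relation $\leq$ on $P/\Theta$ by $[a]\Theta\leq[b]\Theta$ if there exist $a'\in[a]\Theta$ and $b'\in[b]\Theta$ with $a'\leq b'$. Then: (i) $\ker f=\{(x,y)\in P^2\mid f(x)=f(y)\}$ is an $S$-equivalence on $\mathbf P$; (ii) $(P/\Theta,\leq)$ is a poset and the mapping $x\mapsto[x]\Theta$ from $(P,\leq)$ to $(P/\Theta,\leq)$ is strongly monotone.
   Context: For posets $(P,\leq)$, $(Q,\leq)$, a mapping $f\colon P\to Q$ is strongly monotone if it is monotone (i.e.\ $x\leq y$ implies $f(x)\leq f(y)$) and whenever $a,b\in P$ satisfy $f(a)\leq f(b)$ there exist $a',b'\in P$ with $f(a')=f(a)$, $f(b')=f(b)$ and $a'\leq b'$. An equivalence relation $\Theta$ on a poset $(P,\leq)$ is an $S$-equivalence if: (i) whenever $a,b,b',c\in P$ with $a\leq b$, $b'\leq c$ and $(b,b')\in\Theta$, there exist $a'\in[a]\Theta$ and $c'\in[c]\Theta$ with $a'\leq c'$; and (ii) whenever $a,a',b,b'\in P$ with $a\leq b$, $b'\leq a'$ and $(a,a'),(b,b')\in\Theta$, we have $(a,b)\in\Theta$. -}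

module Defs where

open import Level using (Level; _⊔_)
open import Data.Product using (Σ; _×_; ∃-syntax)
open import Relation.Binary.Core using (Rel)
open import Relation.Binary.Structures using (IsEquivalence; IsPartialOrder)
open import Relation.Binary.PropositionalEquality using (_≡_)

private variable
  a b ℓ₁ ℓ₂ ℓ₃ ℓ₄ ℓ : Level

IsPoset : {P : Set a} → Rel P ℓ₁ → Set (a ⊔ ℓ₁)
IsPoset _≤_ = IsPartialOrder _≡_ _≤_

Monotone : {A : Set a} {B : Set b} → Rel A ℓ₁ → Rel B ℓ₂ → (A → B) → Set (a ⊔ ℓ₁ ⊔ ℓ₂)
Monotone _≤A_ _≤B_ f = ∀ {x y} → x ≤A y → f x ≤B f y

-- Strongly monotone map.  The codomain equality _≈B_ is a parameter so that
-- the definition also applies to a quotient represented as a setoid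
-- (for a plain poset take _≈B_ = _≡_).
StronglyMonotone : {A : Set a} {B : Set b} →
  Rel A ℓ₁ → (_≈B_ : Rel B ℓ₂) → Rel B ℓ₃ → (A → B) → Set (a ⊔ ℓ₁ ⊔ ℓ₂ ⊔ ℓ₃)
StronglyMonotone {A = A} _≤A_ _≈B_ _≤B_ f =
  Monotone _≤A_ _≤B_ f ×
  (∀ x y → f x ≤B f y →
     ∃[ x' ] ∃[ y' ] (f x' ≈B f x × f y' ≈B f y × x' ≤A y'))

-- S-equivalence on a poset (P, ≤).  (a , x) ∈ Θ is written Θ a x;
-- x ∈ [a]Θ means Θ a x.
IsSEquivalence : {P : Set a} → Rel P ℓ₁ → Rel P ℓ → Set (a ⊔ ℓ₁ ⊔ ℓ)
IsSEquivalence {P = P} _≤_ Θ =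
  IsEquivalence Θ ×
  (∀ x y y' z → x ≤ y → y' ≤ z → Θ y y' →
     ∃[ x' ] ∃[ z' ] (Θ x x' × Θ z z' × x' ≤ z')) ×
  (∀ x x' y y' → x ≤ y → y' ≤ x' → Θ x x' → Θ y y' → Θ x y)

ker : {P : Set a} {Q : Set b} → (P → Q) → Rel P b
ker f x y = f x ≡ f y

-- The induced relation on P/Θ, with P/Θ represented by P up to Θ:
-- [x]Θ ≤ [y]Θ iff there exist x' ∈ [x]Θ, y' ∈ [y]Θ with x' ≤ y'.
quotOrder : {P : Set a} → Rel P ℓ₁ → Rel P ℓ → Rel P (a ⊔ ℓ₁ ⊔ ℓ)
quotOrder _≤_ Θ x y = ∃[ x' ] ∃[ y' ] (Θ x x' × Θ y y' × x' ≤ y')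

module Submission where

open import Defs
open import Level using (Level)
open import Data.Product using (_×_; _,_; proj₁; proj₂; ∃-syntax)
open import Relation.Binary.Core using (Rel)
open import Relation.Binary.Definitions using (Reflexive; Transitive; Antisymmetric)
open import Relation.Binary.PropositionalEquality using (_≡_; sym)
import Relation.Binary.PropositionalEquality as ≡
open import Relation.Binary.Structures using (IsPartialOrder; IsEquivalence)
import Relation.Binary.Construct.On as On

module _ {a b ℓ₁ ℓ₂} {P : Set a} {Q : Set b} {_≤P_ : Rel P ℓ₁} {_≤Q_ : Rel Q ℓ₂}
         (Q-isPoset : IsPoset _≤Q_) {f : P → Q}
         (f-strongly : StronglyMonotone _≤P_ _≡_ _≤Q_ f) where

  open IsPartialOrder Q-isPoset using (antisym)
    renaming (trans to ≤Q-trans; ≲-respʳ-≈ to ≤Q-respʳ-≡; ≲-respˡ-≈ to ≤Q-respˡ-≡)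

  private
    f-mono : Monotone _≤P_ _≤Q_ f
    f-mono = proj₁ f-strongly

  ker-isEquivalence : IsEquivalence (ker f)
  ker-isEquivalence = On.isEquivalence f ≡.isEquivalence

  -- f x ≤ f y = f y' ≤ f z, and strong monotonicity lifts f x ≤ f z back to P.
  ker-lift-≤ : ∀ x y y' z → x ≤P y → y' ≤P z → ker f y y' →
               ∃[ x' ] ∃[ z' ] (ker f x x' × ker f z z' × x' ≤P z')
  ker-lift-≤ x y y' z x≤y y'≤z fy≡fy'
    with proj₂ f-strongly x z (≤Q-trans (≤Q-respʳ-≡ fy≡fy' (f-mono x≤y)) (f-mono y'≤z))
  ... | x' , z' , fx'≡fx , fz'≡fz , x'≤z' = x' , z' , sym fx'≡fx , sym fz'≡fz , x'≤z'

  ker-squeeze : ∀ x x' y y' → x ≤P y → y' ≤P x' → ker f x x' → ker f y y' → ker f x y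
  ker-squeeze x x' y y' x≤y y'≤x' fx≡fx' fy≡fy' =
    antisym (f-mono x≤y) (≤Q-respˡ-≡ (sym fy≡fy') (≤Q-respʳ-≡ (sym fx≡fx') (f-mono y'≤x')))

  ker-isSEquivalence : IsSEquivalence _≤P_ (ker f)
  ker-isSEquivalence = ker-isEquivalence , ker-lift-≤ , ker-squeeze

module _ {a ℓ₁ ℓ} {P : Set a} {_≤_ : Rel P ℓ₁} {Θ : Rel P ℓ}
         (Θ-isSEquivalence : IsSEquivalence _≤_ Θ) where

  private
    _⊑_ : Rel P _
    _⊑_ = quotOrder _≤_ Θ

  open IsEquivalence (proj₁ Θ-isSEquivalence) renaming (refl to Θ-refl; sym to Θ-sym; trans to Θ-trans)

  quotOrder-reflexive : Reflexive _≤_ → ∀ {x y} → Θ x y → x ⊑ y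
  quotOrder-reflexive ≤-refl {x} Θxy = x , x , Θ-refl , Θ-sym Θxy , ≤-refl

  -- Condition (i) of an S-equivalence, applied at the common class of y₁ and y₂.
  quotOrder-trans : Transitive _⊑_
  quotOrder-trans (x₁ , y₁ , Θxx₁ , Θyy₁ , x₁≤y₁) (y₂ , z₂ , Θyy₂ , Θzz₂ , y₂≤z₂)
    with proj₁ (proj₂ Θ-isSEquivalence) x₁ y₁ y₂ z₂ x₁≤y₁ y₂≤z₂ (Θ-trans (Θ-sym Θyy₁) Θyy₂)
  ... | x' , z' , Θx₁x' , Θz₂z' , x'≤z' = x' , z' , Θ-trans Θxx₁ Θx₁x' , Θ-trans Θzz₂ Θz₂z' , x'≤z'

  quotOrder-antisym : Antisymmetric Θ _⊑_
  quotOrder-antisym (x₁ , y₁ , Θxx₁ , Θyy₁ , x₁≤y₁) (y₂ , x₂ , Θyy₂ , Θxx₂ , y₂≤x₂) =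
    Θ-trans Θxx₁ (Θ-trans Θx₁y₁ (Θ-sym Θyy₁))
    where
    Θx₁y₁ : Θ x₁ y₁
    Θx₁y₁ = proj₂ (proj₂ Θ-isSEquivalence) x₁ x₂ y₁ y₂ x₁≤y₁ y₂≤x₂
              (Θ-trans (Θ-sym Θxx₁) Θxx₂) (Θ-trans (Θ-sym Θyy₁) Θyy₂)

  quotOrder-isPartialOrder : Reflexive _≤_ → IsPartialOrder Θ _⊑_
  quotOrder-isPartialOrder ≤-refl = record
    { isPreorder = record
      { isEquivalence = proj₁ Θ-isSEquivalence
      ; reflexive     = quotOrder-reflexive ≤-refl
      ; trans         = quotOrder-trans
      }
    ; antisym = quotOrder-antisym
    }

  quotient-stronglyMonotone : StronglyMonotone _≤_ Θ _⊑_ (λ x → x)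
  quotient-stronglyMonotone =
    (λ {x} {y} x≤y → x , y , Θ-refl , Θ-refl , x≤y) ,
    λ { x y (x' , y' , Θxx' , Θyy' , x'≤y') → x' , y' , Θ-sym Θxx' , Θ-sym Θyy' , x'≤y' }

theorem5p4 : {a ℓ₁ ℓ : Level} {P : Set a} (_≤_ : Rel P ℓ₁) (Θ : Rel P ℓ) (f : P → P) →
    IsPoset _≤_ → StronglyMonotone _≤_ _≡_ _≤_ f → IsSEquivalence _≤_ Θ →
    IsSEquivalence _≤_ (ker f) ×
    (IsPartialOrder Θ (quotOrder _≤_ Θ) ×
     StronglyMonotone _≤_ Θ (quotOrder _≤_ Θ) (λ x → x))
theorem5p4 _≤_ Θ f ≤-isPoset f-strongly Θ-isSEquivalence =
  ker-isSEquivalence ≤-isPoset f-strongly ,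
  quotOrder-isPartialOrder Θ-isSEquivalence (IsPartialOrder.refl ≤-isPoset) ,
  quotient-stronglyMonotone Θ-isSEquivalence
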